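{- Let $C$ be a DACA whose input alphabet contains $\{0,1\}$, and let $w \in \{0,1\}^+$ be a word which $C$ decides in exactly $\tau$ steps. Then for every word $w' \in \{0,1\}^+$ with $p_{2\tau}(w) = p_{2\tau}(w')$, $I_{2\tau+1}(w') = I_{2\tau+1}(w)$, and $s_{2\tau}(w) = s_{2\tau}(w')$, $C$ decides $w'$ in at most $\tau$ steps, and $w \in L(C)$ holds if and only if $w' \in L(C)$.
   Context: A cellular automaton (CA) is $C=(Q,\delta,\Sigma)$ with finite state set $Q$, local rule $\delta\colon Q^3\to Q$, input alphabet $\Sigma\subseteq Q$, and an inactive state $q\in Q\setminus\Sigma$ with $\delta(z_1,z_2,z_3)=q$ iff $z_2=q$; the global map is $\Delta(c)(z)=\delta(c(z-1),c(z),c(z+1))$ on $Q^{\mathbb{Z}}$. For input $w\in\Sigma^+$ the initial configuration $c_0$ has $c_0(i)=w(i)$ for $0\le i<|w|$ and $q$ elsewhere. For $F\subseteq Q\setminus\{q\}$, a configuration $\Delta^\tau(c_0)$ is $F$-final if all its cells are in $F\cup\{q\}$. A decider ACA (DACA) is a CA with nonempty disjoint sets $A,R\subseteq Q\setminus\{q\}$ of accept and reject states such that every input $w\in\Sigma^+$ leads to an $A$-final or an $R$-final configuration; $C$ accepts $w$ if it reaches an $A$-final configuration with no earlier $R$-final configuration, and rejects $w$ if it reaches an $R$-final configuration with no earlier $A$-final one. The number of steps in which $C$ decides $w$ is the number of steps until the first $A$- or $R$-final configuration. $L(C)$ is the set of accepted words. For a word $w$ and $k\in\mathbb{N}_0$,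 $p_k(w)$, $s_k(w)$, $I_k(w)$ denote the prefix of length $k$, the suffix of length $k$, and the set of infixes of length $k$ of $w$, with $p_k(w)=s_k(w)=w$ and $I_k(w)=\{w\}$ whenever $k\ge|w|$. -}

module Defs where

open import Data.Nat using (ℕ; zero; suc; _≤_; _<_; _∸_)
open import Data.Integer using (ℤ; +_; -[1+_]) renaming (_+_ to _+ℤ_; _-_ to _-ℤ_)
open import Data.Fin using (Fin)
open import Data.Fin.Subset using (Subset; _∈_; _∉_; Nonempty)
open import Data.Bool using (Bool; true; false)
open import Data.List using (List; []; _∷_; length; take; drop; _++_; map)
open import Data.List.Relation.Unary.All using (All)
open import Data.Product using (_×_; Σ; ∃; ∃-syntax; _,_)
open import Data.Sum using (_⊎_)
open import Data.Empty using (⊥)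
open import Relation.Nullary using (¬_)
open import Relation.Binary.PropositionalEquality using (_≡_; _≢_)
open import Function.Bundles using (_⇔_)

record CA : Set where
  field
    size   : ℕ
    δ      : Fin size → Fin size → Fin size → Fin size
    Σin    : Subset size
    q      : Fin size
    q∉Σ    : q ∉ Σin
    δ-inactive : ∀ z₁ z₂ z₃ → (δ z₁ z₂ z₃ ≡ q) ⇔ (z₂ ≡ q)

module _ (C : CA) where
  open CA C

  State : Set
  State = Fin size

  Config : Set
  Config = ℤ → State

  Δ : Config → Config
  Δ c z = δ (c (z -ℤ + 1)) (c z) (c (z +ℤ + 1))

  Δ^ : ℕ → Config → Config
  Δ^ zero    c = c
  Δ^ (suc t) c = Δ (Δ^ t c)

  lookupOr : List State → ℕ → State
  lookupOr []       _       = q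
  lookupOr (a ∷ w)  zero    = a
  lookupOr (a ∷ w)  (suc i) = lookupOr w i

  init : List State → Config
  init w (+ i)    = lookupOr w i
  init w -[1+ _ ] = q

  Final : Subset size → Config → Set
  Final F c = ∀ z → (c z ∈ F) ⊎ (c z ≡ q)

  IsInput : List State → Set
  IsInput w = (w ≢ []) × All (_∈ Σin) w

record DACA : Set where
  field
    ca  : CA
  open CA ca public
  field
    A R      : Subset size
    A-ne     : Nonempty A
    R-ne     : Nonempty R
    q∉A      : q ∉ A
    q∉R      : q ∉ R
    disjoint : ∀ x → x ∈ A → x ∉ R
    decider  : ∀ w → IsInput ca w →
               ∃[ t ] (Final ca A (Δ^ ca t (init ca w)) ⊎ Final ca R (Δ^ ca t (init ca w)))

module _ (D : DACA) where
  open DACA D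

  DecidesIn : List (Fin size) → ℕ → Set
  DecidesIn w τ =
    (Final ca A (Δ^ ca τ (init ca w)) ⊎ Final ca R (Δ^ ca τ (init ca w)))
    × (∀ t → t < τ → ¬ Final ca A (Δ^ ca t (init ca w)) × ¬ Final ca R (Δ^ ca t (init ca w)))

  Accepts : List (Fin size) → Set
  Accepts w = ∃[ τ ] (Final ca A (Δ^ ca τ (init ca w))
                     × (∀ t → t < τ → ¬ Final ca R (Δ^ ca t (init ca w))))

  InL : List (Fin size) → Set
  InL = Accepts

-- The alphabet {0,1} is contained in Σ: an injective naming of the two
-- symbols 0 (false) and 1 (true) by input states.
record BinaryInput (D : DACA) : Set where
  open DACA D
  field
    bit     : Bool → Fin size
    bit-inj : ∀ a b → bit a ≡ bit b → a ≡ b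
    bit∈Σ   : ∀ b → bit b ∈ Σin

-- prefix p_k(w), suffix s_k(w) (both = w when k ≥ |w|)
pre : {X : Set} → ℕ → List X → List X
pre k w = take k w

suf : {X : Set} → ℕ → List X → List X
suf k w = drop (length w ∸ k) w

-- u ∈ I_k(w): u is an infix of w of length k, or k ≥ |w| and u = w
InfixOf : {X : Set} → ℕ → List X → List X → Set
InfixOf k w u =
  (length w ≤ k × u ≡ w)
  ⊎ (k < length w × length u ≡ k × ∃[ x ] ∃[ y ] (w ≡ x ++ u ++ y))

SameInfixes : {X : Set} → ℕ → List X → List X → Set
SameInfixes k w w' = ∀ u → InfixOf k w u ⇔ InfixOf k w' u

-- A cell only sees its two neighbours, so the state of cell z after t ≤ τ
-- steps is determined by the window of radius τ around z in the initial
-- configuration.  The hypotheses on w' guarantee that every such window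
-- of the initial configuration of w' (padded with the inactive state on both
-- sides) also occurs in that of w: windows hanging over the left end are
-- fixed by the common prefix, those hanging over the right end by the common
-- suffix, and the others are infixes of length 2τ + 1.  Hence for t ≤ τ every
-- cell of Δᵗ(c₀(w')) also occurs in Δᵗ(c₀(w)), and conversely, so the two
-- computations become A- or R-final at exactly the same times up to τ.
module Submission where

open import Defs
open import Data.Nat using (ℕ; zero; suc; _+_; _*_; _∸_; _≤_; _<_; _<?_; _≤?_; s≤s)
open import Data.Nat.Properties
open import Data.Integer using (ℤ; +_; -[1+_]; _⊖_; +≤+) renaming (_+_ to _+ℤ_; _-_ to _-ℤ_)
import Data.Integer.Properties as ℤ
open import Data.Integer.Tactic.RingSolver using (solve-∀)
open import Data.Bool using (Bool)
open import Data.List using (List; []; _∷_; map; length; take; drop; _++_)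
open import Data.List.Properties using (length-take; length-drop; take-all; take++drop≡id)
open import Data.Product using (_×_; ∃-syntax; _,_; proj₁; proj₂)
open import Data.Sum using (inj₁; inj₂)
import Data.Sum as Sum
open import Data.Empty using (⊥-elim)
open import Data.Fin.Subset using (Subset; _∈_)
open import Function using (_∘_; id)
open import Function.Bundles using (_⇔_; mk⇔; Equivalence)
import Function.Properties.Equivalence as ⇔
open import Relation.Nullary using (yes; no)
open import Relation.Binary using (tri<; tri≈; tri>)
open import Relation.Binary.PropositionalEquality
  using (_≡_; _≢_; _≗_; refl; sym; trans; cong; subst; module ≡-Reasoning)

open ≡-Reasoning

SameWindow : {Y : Set} → ℕ → (ℤ → Y) → ℤ → (ℤ → Y) → ℤ → Set
SameWindow n g s h s' = ∀ k → k ≤ n → g (s +ℤ + k) ≡ h (s' +ℤ + k)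

WindowsOccurIn : {Y : Set} → ℕ → (ℤ → Y) → (ℤ → Y) → Set
WindowsOccurIn n g h = ∀ s → ∃[ s' ] SameWindow n g s h s'

WindowsOccurIn-resp : {Y : Set} {n : ℕ} {g g' h h' : ℤ → Y} → g' ≗ g → h' ≗ h →
                      WindowsOccurIn n g h → WindowsOccurIn n g' h'
WindowsOccurIn-resp g'≗g h'≗h occur s with occur s
... | s' , same = s' , λ k k≤n → trans (g'≗g _) (trans (same k k≤n) (sym (h'≗h _)))

module PaddedWords {X Y : Set} (f : X → Y) (blank : Y) where

  at : List X → ℕ → Y
  at []      _       = blank
  at (x ∷ v) zero    = f x
  at (x ∷ v) (suc j) = at v j

  extend : List X → ℤ → Y
  extend v (+ j)    = at v j
  extend v -[1+ _ ] = blank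

  at-take : ∀ v n j → j < n → at (take n v) j ≡ at v j
  at-take []      (suc n) j       _         = refl
  at-take (x ∷ v) (suc n) zero    _         = refl
  at-take (x ∷ v) (suc n) (suc j) (s≤s j<n) = at-take v n j j<n

  at-drop : ∀ v m j → at (drop m v) j ≡ at v (m + j)
  at-drop v       zero    j = refl
  at-drop []      (suc m) j = refl
  at-drop (x ∷ v) (suc m) j = at-drop v m j

  at-++ˡ : ∀ u y j → j < length u → at (u ++ y) j ≡ at u j
  at-++ˡ (x ∷ u) y zero    _         = refl
  at-++ˡ (x ∷ u) y (suc j) (s≤s j<u) = at-++ˡ u y j j<u

  at-++ʳ : ∀ x y j → at (x ++ y) (length x + j) ≡ at y j
  at-++ʳ []      y j = refl
  at-++ʳ (a ∷ x) y j = at-++ʳ x y j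

  at-InfixOf : ∀ {n v u} → InfixOf n v u → ∃[ a ] (∀ k → k < n → at u k ≡ at v (a + k))
  at-InfixOf (inj₁ (_ , refl)) = 0 , λ _ _ → refl
  at-InfixOf {u = u} (inj₂ (_ , refl , x , y , refl)) = length x , λ k k<n → begin
    at u k                     ≡⟨ at-++ˡ u y k k<n ⟨
    at (u ++ y) k              ≡⟨ at-++ʳ x (u ++ y) k ⟨
    at (x ++ u ++ y) (length x + k) ∎

  take-drop-InfixOf : ∀ m (v : List X) b → b + m ≤ length v → InfixOf m v (take m (drop b v))
  take-drop-InfixOf m v b b+m≤v with length v ≤? m
  ... | yes v≤m with n≤0⇒n≡0 (+-cancelʳ-≤ m b 0 (≤-trans b+m≤v v≤m))
  ...   | refl = inj₁ (v≤m , take-all m v v≤m)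
  take-drop-InfixOf m v b b+m≤v | no v≰m =
    inj₂ (≰⇒> v≰m , length-window , take b v , drop m (drop b v) , sym split)
    where
    m≤rest : m ≤ length (drop b v)
    m≤rest = subst (m ≤_) (sym (length-drop b v))
               (m+n≤o⇒m≤o∸n m (subst (_≤ length v) (+-comm b m) b+m≤v))
    length-window : length (take m (drop b v)) ≡ m
    length-window = trans (length-take m (drop b v)) (m≤n⇒m⊓n≡m m≤rest)
    split : take b v ++ take m (drop b v) ++ drop m (drop b v) ≡ v
    split = trans (cong (take b v ++_) (take++drop≡id m (drop b v))) (take++drop≡id b v)

  module _ {n : ℕ} (v v' : List X) where

    prefix-window : pre n v ≡ pre n v' → ∀ p → SameWindow n (extend v') -[1+ p ] (extend v) -[1+ p ]
    -- -[1+ p ] +ℤ + k computes to k ⊖ suc p, which lies below + k ≤ + n.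
    prefix-window same p k k≤n with k ⊖ suc p | ℤ.<-≤-trans (ℤ.m⊖1+n<m k (suc p)) (+≤+ k≤n)
    ... | -[1+ _ ] | _     = refl
    ... | + j      | j<n = begin
      at v' j            ≡⟨ at-take v' n j (ℤ.drop‿+<+ j<n) ⟨
      at (take n v') j   ≡⟨ cong (λ u → at u j) same ⟨
      at (take n v) j    ≡⟨ at-take v n j (ℤ.drop‿+<+ j<n) ⟩
      at v j             ∎

    suffix-window : suf n v ≡ suf n v' → ∀ b → length v' ≤ b + n →
                    ∃[ s' ] SameWindow n (extend v') (+ b) (extend v) s'
    suffix-window same b v'≤b+n with m≤n⇒∃[o]m+o≡n tail≤b
      where
      tail≤b : length v' ∸ n ≤ b
      tail≤b = m≤n+o⇒m∸n≤o (length v') n (subst (length v' ≤_) (+-comm b n) v'≤b+n)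
    ... | e , refl = + (length v ∸ n + e) , λ k _ → begin
      at v' (length v' ∸ n + e + k)          ≡⟨ cong (at v') (+-assoc (length v' ∸ n) e k) ⟩
      at v' (length v' ∸ n + (e + k))        ≡⟨ at-drop v' (length v' ∸ n) (e + k) ⟨
      at (drop (length v' ∸ n) v') (e + k)   ≡⟨ cong (λ u → at u (e + k)) same ⟨
      at (drop (length v ∸ n) v) (e + k)     ≡⟨ at-drop v (length v ∸ n) (e + k) ⟩
      at v (length v ∸ n + (e + k))          ≡⟨ cong (at v) (+-assoc (length v ∸ n) e k) ⟨
      at v (length v ∸ n + e + k)            ∎

    infix-window : (∀ u → InfixOf (suc n) v' u → InfixOf (suc n) v u) → ∀ b → b + n < length v' →
                   ∃[ s' ] SameWindow n (extend v') (+ b) (extend v) s'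
    infix-window infixes b inside with at-InfixOf (infixes window isInfix)
      where
      window = take (suc n) (drop b v')
      isInfix : InfixOf (suc n) v' window
      isInfix = take-drop-InfixOf (suc n) v' b (subst (_≤ length v') (sym (+-suc b n)) inside)
    ... | a , window≗v = + a , λ k k≤n → begin
      at v' (b + k)                           ≡⟨ at-drop v' b k ⟨
      at (drop b v') k                        ≡⟨ at-take (drop b v') (suc n) k (s≤s k≤n) ⟨
      at (take (suc n) (drop b v')) k         ≡⟨ window≗v k (s≤s k≤n) ⟩
      at v (a + k)                            ∎

    window-occurs : pre n v ≡ pre n v' → (∀ u → InfixOf (suc n) v' u → InfixOf (suc n) v u) →
                    suf n v ≡ suf n v' → WindowsOccurIn n (extend v') (extend v)
    window-occurs samePre _ _ -[1+ p ] = -[1+ p ] , prefix-window samePre p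
    window-occurs _ infixes sameSuf (+ b) with b + n <? length v'
    ... | yes inside  = infix-window infixes b inside
    ... | no outside  = suffix-window sameSuf b (≮⇒≥ outside)

module Locality (C : CA) where
  open CA C

  record Agree (c c' : Config C) (z z' : ℤ) (r : ℕ) : Set where
    constructor agreeing
    field
      offset : ∀ k → k ≤ 2 * r → c (z -ℤ + r +ℤ + k) ≡ c' (z' -ℤ + r +ℤ + k)
  open Agree

  Δ-Agree : ∀ {c c' z z' r} → Agree c c' z z' (suc r) → Agree (Δ C c) (Δ C c') z z' r
  Δ-Agree {c} {c'} {z} {z'} {r} agree .offset k k≤2r =
    δ-cong (cell (λ x → x -ℤ + r +ℤ + k -ℤ + 1) k (m≤n⇒m≤1+n (m≤n⇒m≤1+n k≤2r))
                 (λ x → left x (+ r) (+ k)))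
           (cell (λ x → x -ℤ + r +ℤ + k) (suc k) (m≤n⇒m≤1+n (s≤s k≤2r))
                 (λ x → centre x (+ r) (+ k)))
           (cell (λ x → x -ℤ + r +ℤ + k +ℤ + 1) (suc (suc k)) (s≤s (s≤s k≤2r))
                 (λ x → right x (+ r) (+ k)))
    where
    δ-cong : ∀ {a a' b b' d d'} → a ≡ a' → b ≡ b' → d ≡ d' → δ a b d ≡ δ a' b' d'
    δ-cong refl refl refl = refl
    cell : ∀ (pos : ℤ → ℤ) j → j ≤ 2 + 2 * r → (∀ x → pos x ≡ x -ℤ + suc r +ℤ + j) →
           c (pos z) ≡ c' (pos z')
    cell pos j j≤ pos≡ = begin
      c (pos z)                   ≡⟨ cong c (pos≡ z) ⟩
      c (z -ℤ + suc r +ℤ + j)     ≡⟨ agree .offset j (subst (j ≤_) (sym (*-suc 2 r)) j≤) ⟩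
      c' (z' -ℤ + suc r +ℤ + j)   ≡⟨ cong c' (pos≡ z') ⟨
      c' (pos z')                 ∎
    left : ∀ x r k → x -ℤ r +ℤ k -ℤ + 1 ≡ x -ℤ (+ 1 +ℤ r) +ℤ k
    left = solve-∀
    centre : ∀ x r k → x -ℤ r +ℤ k ≡ x -ℤ (+ 1 +ℤ r) +ℤ (+ 1 +ℤ k)
    centre = solve-∀
    right : ∀ x r k → x -ℤ r +ℤ k +ℤ + 1 ≡ x -ℤ (+ 1 +ℤ r) +ℤ (+ 2 +ℤ k)
    right = solve-∀

  Δ^-Agree : ∀ t {c c' z z' r} → Agree c c' z z' (t + r) → Agree (Δ^ C t c) (Δ^ C t c') z z' r
  Δ^-Agree zero    agree = agree
  Δ^-Agree (suc t) {c} {c'} {z} {z'} {r} agree =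
    Δ-Agree (Δ^-Agree t (subst (Agree c c' z z') (sym (+-suc t r)) agree))

  Agree-centre : ∀ {c c' z z' r} → Agree c c' z z' r → c z ≡ c' z'
  Agree-centre {c} {c'} {z} {z'} {r} agree = begin
    c z                       ≡⟨ cong c (cancel z (+ r)) ⟨
    c (z -ℤ + r +ℤ + r)       ≡⟨ agree .offset r (m≤n*m r 2) ⟩
    c' (z' -ℤ + r +ℤ + r)     ≡⟨ cong c' (cancel z' (+ r)) ⟩
    c' z'                     ∎
    where
    cancel : ∀ x r → x -ℤ r +ℤ r ≡ x
    cancel = solve-∀

  WindowsOccurIn⇒Agree : ∀ {c c' r} → WindowsOccurIn (2 * r) c c' → ∀ z → ∃[ z' ] Agree c c' z z' r
  WindowsOccurIn⇒Agree {c} {c'} {r} windows z with windows (z -ℤ + r)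
  ... | s' , same = s' +ℤ + r , agreeing λ k k≤2r →
    trans (same k k≤2r) (cong (λ x → c' (x +ℤ + k)) (sym (cancel s' (+ r))))
    where
    cancel : ∀ x r → x +ℤ r -ℤ r ≡ x
    cancel = solve-∀

  CellsOccurIn : Config C → Config C → Set
  CellsOccurIn c' c = ∀ z → ∃[ z' ] c' z ≡ c z'

  Final-CellsOccurIn : ∀ {F c c'} → CellsOccurIn c' c → Final C F c → Final C F c'
  Final-CellsOccurIn {F} occur final z with occur z
  ... | z' , c'z≡cz' = subst (λ x → x ∈ F Sum.⊎ x ≡ q) (sym c'z≡cz') (final z')

  Δ^-CellsOccurIn : ∀ {τ c c'} → (∀ z → ∃[ z' ] Agree c' c z z' τ) →
                    ∀ t → t ≤ τ → CellsOccurIn (Δ^ C t c') (Δ^ C t c)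
  Δ^-CellsOccurIn {τ} {c} {c'} windows t t≤τ z with windows z
  ... | z' , agree =
    z' , Agree-centre (Δ^-Agree t (subst (Agree c' c z z') (sym (m+[n∸m]≡n t≤τ)) agree))

module InitialWindows (C : CA) {X : Set} (f : X → State C) where
  open CA C
  open PaddedWords f q
  open Locality C

  lookupOr-map : ∀ v j → lookupOr C (map f v) j ≡ at v j
  lookupOr-map []      j       = refl
  lookupOr-map (x ∷ v) zero    = refl
  lookupOr-map (x ∷ v) (suc j) = lookupOr-map v j

  init-map : ∀ v z → init C (map f v) z ≡ extend v z
  init-map v (+ j)    = lookupOr-map v j
  init-map v -[1+ _ ] = refl

  init-Agree : ∀ r (v v' : List X) → pre (2 * r) v ≡ pre (2 * r) v' →
               (∀ u → InfixOf (suc (2 * r)) v' u → InfixOf (suc (2 * r)) v u) →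
               suf (2 * r) v ≡ suf (2 * r) v' →
               ∀ z → ∃[ z' ] Agree (init C (map f v')) (init C (map f v)) z z' r
  init-Agree r v v' samePre infixes sameSuf =
    WindowsOccurIn⇒Agree (WindowsOccurIn-resp (init-map v') (init-map v)
                           (window-occurs v v' samePre infixes sameSuf))

module Decisions (D : DACA) where
  open DACA D

  FinalAt : Subset size → List (State ca) → ℕ → Set
  FinalAt F V t = Final ca F (Δ^ ca t (init ca V))

  SameFinalityUpTo : ℕ → List (State ca) → List (State ca) → Set
  SameFinalityUpTo τ V V' = ∀ F t → t ≤ τ → FinalAt F V t ⇔ FinalAt F V' t

  Accepts⇔FinalAt : ∀ {V τ} → DecidesIn D V τ → Accepts D V ⇔ FinalAt A V τ
  Accepts⇔FinalAt {V} {τ} (decided , undecided) =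
    mk⇔ accepted (λ final → τ , final , λ t t<τ → proj₂ (undecided t t<τ))
    where
    accepted : Accepts D V → FinalAt A V τ
    accepted (τ' , final , notRejected) with <-cmp τ' τ
    ... | tri< τ'<τ _ _ = ⊥-elim (proj₁ (undecided τ' τ'<τ) final)
    ... | tri≈ _ refl _ = final
    ... | tri> _ _ τ<τ' = Sum.[ id , (λ finalR → ⊥-elim (notRejected τ τ<τ' finalR)) ] decided

  SameFinalityUpTo⇒DecidesIn : ∀ {τ V V'} → SameFinalityUpTo τ V V' →
                               DecidesIn D V τ → DecidesIn D V' τ
  SameFinalityUpTo⇒DecidesIn {τ} same (decided , undecided) =
    Sum.map (Equivalence.to (same A τ ≤-refl)) (Equivalence.to (same R τ ≤-refl)) decided ,
    λ t t<τ → let (notA , notR) = undecided t t<τ in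
      notA ∘ Equivalence.from (same A t (<⇒≤ t<τ)) , notR ∘ Equivalence.from (same R t (<⇒≤ t<τ))

  SameFinalityUpTo⇒Accepts⇔ : ∀ {τ V V'} → SameFinalityUpTo τ V V' → DecidesIn D V τ →
                              Accepts D V ⇔ Accepts D V'
  SameFinalityUpTo⇒Accepts⇔ {τ} same decides =
    ⇔.trans (Accepts⇔FinalAt decides)
      (⇔.trans (same A τ ≤-refl) (⇔.sym (Accepts⇔FinalAt (SameFinalityUpTo⇒DecidesIn same decides))))

lemma3 : (C : DACA) (B : BinaryInput C) (w : List Bool) (τ : ℕ) →
    w ≢ [] → DecidesIn C (map (BinaryInput.bit B) w) τ →
    (w' : List Bool) → w' ≢ [] →
    pre (2 * τ) w ≡ pre (2 * τ) w' →
    SameInfixes (2 * τ + 1) w' w →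
    suf (2 * τ) w ≡ suf (2 * τ) w' →
    (∃[ τ' ] (τ' ≤ τ × DecidesIn C (map (BinaryInput.bit B) w') τ'))
    × (InL C (map (BinaryInput.bit B) w) ⇔ InL C (map (BinaryInput.bit B) w'))
lemma3 C B w τ _ decides w' _ samePre sameInfixes sameSuf =
  (τ , ≤-refl , SameFinalityUpTo⇒DecidesIn same decides) , SameFinalityUpTo⇒Accepts⇔ same decides
  where
  open DACA C
  open BinaryInput B
  open Decisions C
  open Locality ca
  open InitialWindows ca bit

  infixes : SameInfixes (suc (2 * τ)) w' w
  infixes = subst (λ m → SameInfixes m w' w) (+-comm (2 * τ) 1) sameInfixes

  windows-of-w'-in-w : ∀ z → ∃[ z' ] Agree (init ca (map bit w')) (init ca (map bit w)) z z' τ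
  windows-of-w'-in-w = init-Agree τ w w' samePre (Equivalence.to ∘ infixes) sameSuf
  windows-of-w-in-w' : ∀ z → ∃[ z' ] Agree (init ca (map bit w)) (init ca (map bit w')) z z' τ
  windows-of-w-in-w' = init-Agree τ w' w (sym samePre) (Equivalence.from ∘ infixes) (sym sameSuf)

  same : SameFinalityUpTo τ (map bit w) (map bit w')
  same F t t≤τ = mk⇔ (Final-CellsOccurIn (Δ^-CellsOccurIn windows-of-w'-in-w t t≤τ))
                     (Final-CellsOccurIn (Δ^-CellsOccurIn windows-of-w-in-w' t t≤τ))
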